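{- Let $n\ge 11$ and $T_{n,n-3}=\frac{n(n+1)}{2}-(n-3)$. Then $\#\mathbb U^*_{T_{n,n-3}}=1$.
   Context: A partition of $N$ into distinct parts is a sequence of positive integers $\lambda_1<\dots<\lambda_t$ summing to $N$ with $t\ge 2$. Its missing parts are the elements of $\{1,\dots,\lambda_t\}\setminus\{\lambda_1,\dots,\lambda_t\}$. $\lambda$ is refinable if two distinct missing parts sum to a part of $\lambda$, unrefinable otherwise; $\mathbb U_N$ is the set of unrefinable partitions of $N$. $\mathbb U^*_N$ is the set of $\lambda\in\mathbb U_N$ whose largest part is the maximum of the largest parts over all of $\mathbb U_N$. Standing assumption: $n\ge 11$. -}

module Defs where

open import Data.Nat using (ℕ; _+_; _*_; _∸_; _/_; _≤_; _<_; _⊔_; suc)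
open import Data.List using (List; length; foldr)
open import Data.Nat.ListAction using (sum)
open import Data.List.Membership.Propositional using (_∈_; _∉_)
open import Data.List.Relation.Unary.All using (All)
open import Data.List.Relation.Unary.Linked using (Linked)
open import Data.Product using (Σ; ∃; _×_)
open import Relation.Binary.PropositionalEquality using (_≡_; _≢_)
open import Relation.Nullary using (¬_)

record DistinctPartition (N : ℕ) (λs : List ℕ) : Set where
  field
    increasing : Linked _<_ λs
    positive   : All (λ x → 1 ≤ x) λs
    atLeastTwo : 2 ≤ length λs
    sumIsN     : sum λs ≡ N

largest : List ℕ → ℕ
largest = foldr _⊔_ 0

Missing : List ℕ → ℕ → Set
Missing λs m = (1 ≤ m) × (m ≤ largest λs) × (m ∉ λs)

Refinable : List ℕ → Set
Refinable λs = Σ ℕ λ a → Σ ℕ λ b →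
  (a ≢ b) × Missing λs a × Missing λs b × ((a + b) ∈ λs)

Unrefinable : List ℕ → Set
Unrefinable λs = ¬ Refinable λs

InU : ℕ → List ℕ → Set
InU N λs = DistinctPartition N λs × Unrefinable λs

InUStar : ℕ → List ℕ → Set
InUStar N λs = InU N λs × (∀ μ → InU N μ → largest μ ≤ largest λs)

T : ℕ → ℕ → ℕ
T n k = (n * suc n) / 2 ∸ k

{-# OPTIONS --safe #-}
module Submission where

-- Write n = j + 5 and let L be the largest part of an unrefinable partition μ of
-- N = T_{n,n-3} = (1 + ⋯ + j) + 4j + 13.  For 2a < L the numbers a and L - a cannot
-- both be missing, since they would refine L; so the pairs {a, L - a} with a ≤ m
-- contribute at least 1 + ⋯ + m to N besides L itself.  Taking m = j + 3 gives
-- L ≤ 2j + 6 = 2n - 4, which is attained by {1, …, j, j + 2, j + 5, 2j + 6}.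
-- If L = 2j + 6, each pair with a ≤ j contributes either a or at least a + 6, while
-- N exceeds (1 + ⋯ + j) + (j + 1) + (j + 2) + L by only 4.  Hence every such pair
-- contributes exactly a, and the slack of 4 can only be spent on j + 5 in place of
-- j + 1: the partition is the one above.

open import Defs
open import Data.Nat
open import Data.Nat.Properties
open import Data.Nat.DivMod using (m*n/n≡m)
open import Data.Nat.ListAction using (sum)
open import Data.Nat.ListAction.Properties using (sum-++)
open import Data.Nat.Tactic.RingSolver using (solve-∀)
open import Data.List using (List; []; _∷_; _++_; length; applyUpTo)
open import Data.List.Properties using (length-++)
open import Data.List.Membership.Propositional using (_∈_; _∉_)
open import Data.List.Membership.Propositional.Properties
  using (∈-++⁺ˡ; ∈-++⁺ʳ; ∈-++⁻; ∈-applyUpTo⁺; ∈-applyUpTo⁻)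
open import Data.List.Membership.DecPropositional _≟_ using (_∈?_)
open import Data.List.Relation.Unary.Any using (here; there)
open import Data.List.Relation.Unary.All as All using (All; []; _∷_)
import Data.List.Relation.Unary.All.Properties as All
open import Data.List.Relation.Unary.AllPairs using (AllPairs; []; _∷_)
import Data.List.Relation.Unary.AllPairs.Properties as AllPairs
open import Data.List.Relation.Unary.Linked.Properties using (Linked⇒AllPairs; AllPairs⇒Linked)
open import Data.Product using (Σ; ∃; ∃₂; _×_; _,_; proj₁; proj₂)
open import Data.Sum using (_⊎_; inj₁; inj₂; [_,_]′)
open import Data.Empty using (⊥; ⊥-elim)
open import Function using (_∘_)
open import Relation.Nullary using (Dec; yes; no)
open import Relation.Binary.PropositionalEquality

-- Sums over ranges of naturals

rangeSum : (ℕ → ℕ) → ℕ → ℕ → ℕ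
rangeSum f lo zero      = 0
rangeSum f lo (suc len) = f lo + rangeSum f (suc lo) len

InRange : ℕ → ℕ → ℕ → Set
InRange lo len y = lo ≤ y × y < lo + len

OnRange : (ℕ → Set) → ℕ → ℕ → Set
OnRange P lo len = ∀ {y} → InRange lo len y → P y

inRange-zero : ∀ {lo y} → InRange lo 0 y → ⊥
inRange-zero {lo} {y} (lo≤y , y<lo) = <⇒≱ (subst (y <_) (+-identityʳ lo) y<lo) lo≤y

inRange-head : ∀ lo len → InRange lo (suc len) lo
inRange-head lo len = ≤-refl , m<m+n lo z<s

inRange-suc⁻ : ∀ {lo len y} → InRange (suc lo) len y → InRange lo (suc len) y
inRange-suc⁻ {lo} {len} {y} (lo<y , y<) = <⇒≤ lo<y , subst (y <_) (sym (+-suc lo len)) y<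

inRange-suc⁺ : ∀ {lo len y} → lo < y → InRange lo (suc len) y → InRange (suc lo) len y
inRange-suc⁺ {lo} {len} {y} lo<y (_ , y<) = lo<y , subst (y <_) (+-suc lo len) y<

rangeSum-+ : ∀ f lo k l → rangeSum f lo (k + l) ≡ rangeSum f lo k + rangeSum f (lo + k) l
rangeSum-+ f lo zero    l = cong (λ lo′ → rangeSum f lo′ l) (sym (+-identityʳ lo))
rangeSum-+ f lo (suc k) l = begin
  f lo + rangeSum f (suc lo) (k + l)
    ≡⟨ cong (f lo +_) (rangeSum-+ f (suc lo) k l) ⟩
  f lo + (rangeSum f (suc lo) k + rangeSum f (suc lo + k) l)
    ≡⟨ sym (+-assoc (f lo) _ _) ⟩
  f lo + rangeSum f (suc lo) k + rangeSum f (suc lo + k) l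
    ≡⟨ cong (λ lo′ → f lo + rangeSum f (suc lo) k + rangeSum f lo′ l) (sym (+-suc lo k)) ⟩
  f lo + rangeSum f (suc lo) k + rangeSum f (lo + suc k) l ∎
  where open ≡-Reasoning

rangeSum-snoc : ∀ f lo k → rangeSum f lo (suc k) ≡ rangeSum f lo k + f (lo + k)
rangeSum-snoc f lo k = begin
  rangeSum f lo (suc k)              ≡⟨ cong (rangeSum f lo) (+-comm 1 k) ⟩
  rangeSum f lo (k + 1)              ≡⟨ rangeSum-+ f lo k 1 ⟩
  rangeSum f lo k + (f (lo + k) + 0) ≡⟨ cong (rangeSum f lo k +_) (+-identityʳ _) ⟩
  rangeSum f lo k + f (lo + k)       ∎
  where open ≡-Reasoning

rangeSum-cong : ∀ {f g} lo len → OnRange (λ y → f y ≡ g y) lo len →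
                rangeSum f lo len ≡ rangeSum g lo len
rangeSum-cong lo zero      _   = refl
rangeSum-cong lo (suc len) f≡g =
  cong₂ _+_ (f≡g (inRange-head lo len)) (rangeSum-cong (suc lo) len (λ r → f≡g (inRange-suc⁻ r)))

rangeSum-mono : ∀ {f g} lo len → OnRange (λ y → f y ≤ g y) lo len →
                rangeSum f lo len ≤ rangeSum g lo len
rangeSum-mono lo zero      _   = z≤n
rangeSum-mono lo (suc len) f≤g =
  +-mono-≤ (f≤g (inRange-head lo len)) (rangeSum-mono (suc lo) len (λ r → f≤g (inRange-suc⁻ r)))

rangeSum-rigid : ∀ {f g} slack lo len →
                 OnRange (λ y → f y ≡ g y ⊎ g y + suc slack ≤ f y) lo len →
                 rangeSum f lo len ≤ rangeSum g lo len + slack →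
                 OnRange (λ y → f y ≡ g y) lo len
rangeSum-rigid slack lo zero _ _ r = ⊥-elim (inRange-zero r)
rangeSum-rigid {f} {g} slack lo (suc len) close sum≤ = pointwise
  where
    Rf = rangeSum f (suc lo) len
    Rg = rangeSum g (suc lo) len

    g≤f : OnRange (λ y → g y ≤ f y) lo (suc len)
    g≤f r with close r
    ... | inj₁ f≡g   = ≤-reflexive (sym f≡g)
    ... | inj₂ g+s≤f = ≤-trans (m≤m+n _ _) g+s≤f

    head≤ : f lo ≤ g lo + slack
    head≤ = +-cancelʳ-≤ Rg (f lo) (g lo + slack) (begin
      f lo + Rg           ≤⟨ +-monoʳ-≤ (f lo) (rangeSum-mono (suc lo) len (λ r → g≤f (inRange-suc⁻ r))) ⟩
      f lo + Rf           ≤⟨ sum≤ ⟩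
      g lo + Rg + slack   ≡⟨ +-assoc (g lo) Rg slack ⟩
      g lo + (Rg + slack) ≡⟨ cong (g lo +_) (+-comm Rg slack) ⟩
      g lo + (slack + Rg) ≡⟨ sym (+-assoc (g lo) slack Rg) ⟩
      g lo + slack + Rg   ∎)
      where open ≤-Reasoning

    head≡ : f lo ≡ g lo
    head≡ with close (inRange-head lo len)
    ... | inj₁ f≡g   = f≡g
    ... | inj₂ g+s≤f = ⊥-elim (n≮n slack (+-cancelˡ-≤ (g lo) (suc slack) slack (≤-trans g+s≤f head≤)))

    rest≤ : Rf ≤ Rg + slack
    rest≤ = +-cancelˡ-≤ (g lo) Rf (Rg + slack) (begin
      g lo + Rf           ≡⟨ cong (_+ Rf) (sym head≡) ⟩
      f lo + Rf           ≤⟨ sum≤ ⟩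
      g lo + Rg + slack   ≡⟨ +-assoc (g lo) Rg slack ⟩
      g lo + (Rg + slack) ∎)
      where open ≤-Reasoning

    pointwise : OnRange (λ y → f y ≡ g y) lo (suc len)
    pointwise r with m≤n⇒m<n∨m≡n (proj₁ r)
    ... | inj₂ refl = head≡
    ... | inj₁ lo<y =
      rangeSum-rigid slack (suc lo) len (λ r′ → close (inRange-suc⁻ r′)) rest≤ (inRange-suc⁺ lo<y r)

rangeSum-shift : ∀ f lo k → rangeSum (λ y → f (suc y)) lo k ≡ rangeSum f (suc lo) k
rangeSum-shift f lo zero    = refl
rangeSum-shift f lo (suc k) = cong (f (suc lo) +_) (rangeSum-shift f (suc lo) k)

sum-applyUpTo : ∀ f k → sum (applyUpTo f k) ≡ rangeSum f 0 k
sum-applyUpTo f zero    = refl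
sum-applyUpTo f (suc k) =
  cong (f 0 +_) (trans (sum-applyUpTo (λ y → f (suc y)) k) (rangeSum-shift f 0 k))

triangle : ℕ → ℕ
triangle zero    = 0
triangle (suc m) = triangle m + suc m

rangeSum-id : ∀ m → rangeSum (λ a → a) 1 m ≡ triangle m
rangeSum-id zero    = refl
rangeSum-id (suc m) = trans (rangeSum-snoc (λ a → a) 1 m) (cong (_+ suc m) (rangeSum-id m))

triangle-*2 : ∀ m → triangle m * 2 ≡ m * suc m
triangle-*2 zero    = refl
triangle-*2 (suc m) = begin
  (triangle m + suc m) * 2   ≡⟨ *-distribʳ-+ 2 (triangle m) (suc m) ⟩
  triangle m * 2 + suc m * 2 ≡⟨ cong (_+ suc m * 2) (triangle-*2 m) ⟩
  m * suc m + suc m * 2      ≡⟨ gauss m ⟩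
  suc m * suc (suc m)        ∎
  where
    open ≡-Reasoning
    gauss : ∀ m → m * suc m + suc m * 2 ≡ suc m * suc (suc m)
    gauss = solve-∀

pairSum : (ℕ → ℕ) → ℕ → ℕ → ℕ
pairSum c L a = c a + c (L ∸ a)

rangeSum-pairSum : ∀ c L m → m ≤ L →
                   rangeSum (pairSum c L) 1 m ≡ rangeSum c 1 m + rangeSum c (L ∸ m) m
rangeSum-pairSum c L zero    _   = refl
rangeSum-pairSum c L (suc m) m<L = begin
  rangeSum (pairSum c L) 1 (suc m)
    ≡⟨ rangeSum-snoc (pairSum c L) 1 m ⟩
  rangeSum (pairSum c L) 1 m + (c (suc m) + c (L ∸ suc m))
    ≡⟨ cong (_+ (c (suc m) + c (L ∸ suc m))) (rangeSum-pairSum c L m (<⇒≤ m<L)) ⟩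
  rangeSum c 1 m + rangeSum c (L ∸ m) m + (c (suc m) + c (L ∸ suc m))
    ≡⟨ regroup (rangeSum c 1 m) (rangeSum c (L ∸ m) m) (c (suc m)) (c (L ∸ suc m)) ⟩
  (rangeSum c 1 m + c (suc m)) + (c (L ∸ suc m) + rangeSum c (L ∸ m) m)
    ≡⟨ cong₂ _+_ (sym (rangeSum-snoc c 1 m))
                 (cong (λ lo → c (L ∸ suc m) + rangeSum c lo m) (+-∸-assoc 1 m<L)) ⟩
  rangeSum c 1 (suc m) + rangeSum c (L ∸ suc m) (suc m) ∎
  where
    open ≡-Reasoning
    regroup : ∀ a b x y → a + b + (x + y) ≡ (a + x) + (y + b)
    regroup = solve-∀

rangeSum-fold : ∀ c {L} m d → suc (m + d + m) ≡ L →
                rangeSum c 1 L ≡ rangeSum (pairSum c L) 1 m + rangeSum c (suc m) d + c L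
rangeSum-fold c m d refl = begin
  rangeSum c 1 (suc (m + d + m))
    ≡⟨ rangeSum-snoc c 1 (m + d + m) ⟩
  rangeSum c 1 (m + d + m) + c L
    ≡⟨ cong (_+ c L) (rangeSum-+ c 1 (m + d) m) ⟩
  rangeSum c 1 (m + d) + rangeSum c (suc (m + d)) m + c L
    ≡⟨ cong (λ s → s + rangeSum c (suc (m + d)) m + c L) (rangeSum-+ c 1 m d) ⟩
  rangeSum c 1 m + rangeSum c (suc m) d + rangeSum c (suc (m + d)) m + c L
    ≡⟨ cong (_+ c L) (swap (rangeSum c 1 m) (rangeSum c (suc m) d) (rangeSum c (suc (m + d)) m)) ⟩
  rangeSum c 1 m + rangeSum c (suc (m + d)) m + rangeSum c (suc m) d + c L
    ≡⟨ cong (λ s → s + rangeSum c (suc m) d + c L) (sym pairs) ⟩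
  rangeSum (pairSum c L) 1 m + rangeSum c (suc m) d + c L ∎
  where
    open ≡-Reasoning
    L = suc (m + d + m)
    swap : ∀ a b x → a + b + x ≡ a + x + b
    swap = solve-∀
    L∸m : L ∸ m ≡ suc (m + d)
    L∸m = trans (+-∸-assoc 1 (m≤n+m m (m + d))) (cong suc (m+n∸n≡m (m + d) m))
    pairs : rangeSum (pairSum c L) 1 m ≡ rangeSum c 1 m + rangeSum c (suc (m + d)) m
    pairs = trans (rangeSum-pairSum c L m (≤-trans (m≤n+m m (m + d)) (n≤1+n _)))
                  (cong (λ lo → rangeSum c 1 m + rangeSum c lo m) L∸m)

weight : List ℕ → ℕ → ℕ
weight xs y with y ∈? xs
... | yes _ = y
... | no  _ = 0

weight-∈ : ∀ xs {y} → y ∈ xs → weight xs y ≡ y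
weight-∈ xs {y} y∈ with y ∈? xs
... | yes _  = refl
... | no y∉ = ⊥-elim (y∉ y∈)

weight-∉ : ∀ xs {y} → y ∉ xs → weight xs y ≡ 0
weight-∉ xs {y} y∉ with y ∈? xs
... | yes y∈ = ⊥-elim (y∉ y∈)
... | no _   = refl

weight-∷ : ∀ {x xs y} → y ≢ x → weight (x ∷ xs) y ≡ weight xs y
weight-∷ {x} {xs} {y} y≢x = by-cases (y ∈? xs)
  where
    by-cases : Dec (y ∈ xs) → weight (x ∷ xs) y ≡ weight xs y
    by-cases (yes y∈) = trans (weight-∈ (x ∷ xs) (there y∈)) (sym (weight-∈ xs y∈))
    by-cases (no y∉)  = trans (weight-∉ (x ∷ xs) λ { (here y≡x) → y≢x y≡x ; (there y∈) → y∉ y∈ })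
                              (sym (weight-∉ xs y∉))

sum≡rangeSum-weight : ∀ lo len {xs} → AllPairs _<_ xs → (∀ {x} → x ∈ xs → InRange lo len x) →
                      sum xs ≡ rangeSum (weight xs) lo len
sum≡rangeSum-weight lo zero      {[]}     _ _ = refl
sum≡rangeSum-weight lo zero      {x ∷ _}  _ in-range = ⊥-elim (inRange-zero (in-range (here refl)))
sum≡rangeSum-weight lo (suc len) {[]}     _ _ =
  cong₂ _+_ (sym (weight-∉ [] {lo} λ ())) (sum≡rangeSum-weight (suc lo) len [] λ ())
sum≡rangeSum-weight lo (suc len) {x ∷ xs} (x<xs ∷ sorted) in-range
  with m≤n⇒m<n∨m≡n (proj₁ (in-range (here refl)))
... | inj₂ refl =
  cong₂ _+_ (sym (weight-∈ (lo ∷ xs) (here refl)))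
            (trans (sum≡rangeSum-weight (suc lo) len sorted
                      (λ y∈ → inRange-suc⁺ (All.lookup x<xs y∈) (in-range (there y∈))))
                   (rangeSum-cong (suc lo) len (λ (lo<y , _) → sym (weight-∷ (>⇒≢ lo<y)))))
... | inj₁ lo<x =
  trans (sum≡rangeSum-weight (suc lo) len (x<xs ∷ sorted) in-range′)
        (cong (_+ rangeSum (weight (x ∷ xs)) (suc lo) len) (sym (weight-∉ (x ∷ xs) lo∉)))
  where
    lo<xs : ∀ {y} → y ∈ x ∷ xs → lo < y
    lo<xs (here refl) = lo<x
    lo<xs (there y∈)  = <-trans lo<x (All.lookup x<xs y∈)
    lo∉ : lo ∉ x ∷ xs
    lo∉ lo∈ = n≮n lo (lo<xs lo∈)
    in-range′ : ∀ {y} → y ∈ x ∷ xs → InRange (suc lo) len y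
    in-range′ y∈ = inRange-suc⁺ (lo<xs y∈) (in-range y∈)

largest-∈ : ∀ x xs → largest (x ∷ xs) ∈ x ∷ xs
largest-∈ x []       = here (⊔-identityʳ x)
largest-∈ x (y ∷ ys) with ⊔-sel x (largest (y ∷ ys))
... | inj₁ ≡x = here ≡x
... | inj₂ ≡l = there (subst (_∈ y ∷ ys) (sym ≡l) (largest-∈ y ys))

≤-largest : ∀ {x xs} → x ∈ xs → x ≤ largest xs
≤-largest {x} {_ ∷ ys} (here refl) = m≤m⊔n x (largest ys)
≤-largest {x} {y ∷ ys} (there x∈)  = ≤-trans (≤-largest x∈) (m≤n⊔m y (largest ys))

largest-≤ : ∀ {b} xs → (∀ {x} → x ∈ xs → x ≤ b) → largest xs ≤ b
largest-≤ []       _    = z≤n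
largest-≤ (x ∷ xs) ≤b = ⊔-lub (≤b (here refl)) (largest-≤ xs (λ x∈ → ≤b (there x∈)))

strictlyIncreasing-≡ : ∀ {xs ys} → AllPairs _<_ xs → AllPairs _<_ ys →
                       (∀ {z} → z ∈ xs → z ∈ ys) → (∀ {z} → z ∈ ys → z ∈ xs) → xs ≡ ys
strictlyIncreasing-≡ {[]}     {[]}     _ _ _ _ = refl
strictlyIncreasing-≡ {[]}     {_ ∷ _}  _ _ _ ys⊆xs with ys⊆xs (here refl)
... | ()
strictlyIncreasing-≡ {_ ∷ _}  {[]}     _ _ xs⊆ys _ with xs⊆ys (here refl)
... | ()
strictlyIncreasing-≡ {x ∷ xs} {y ∷ ys} (x<xs ∷ <xs) (y<ys ∷ <ys) xs⊆ys ys⊆xs =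
  cong₂ _∷_ x≡y (strictlyIncreasing-≡ <xs <ys tail⊆ tail⊇)
  where
    x≡y : x ≡ y
    x≡y with xs⊆ys (here refl) | ys⊆xs (here refl)
    ... | here x≡y | _         = x≡y
    ... | there _  | here y≡x  = sym y≡x
    ... | there x∈ | there y∈  = ⊥-elim (<-asym (All.lookup y<ys x∈) (All.lookup x<xs y∈))
    tail⊆ : ∀ {z} → z ∈ xs → z ∈ ys
    tail⊆ z∈ with xs⊆ys (there z∈)
    ... | here z≡y = ⊥-elim (>⇒≢ (All.lookup x<xs z∈) (trans z≡y (sym x≡y)))
    ... | there z∈ys = z∈ys
    tail⊇ : ∀ {z} → z ∈ ys → z ∈ xs
    tail⊇ z∈ with ys⊆xs (there z∈)
    ... | here z≡x = ⊥-elim (>⇒≢ (All.lookup y<ys z∈) (trans z≡x x≡y))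
    ... | there z∈xs = z∈xs

-- Unrefinable partitions

split-part : ∀ {λs p} → Unrefinable λs → p ∈ λs → ∀ {a} → 1 ≤ a → a + a < p →
             a ∈ λs ⊎ p ∸ a ∈ λs
split-part {λs} {p} unrefinable p∈ {a} 1≤a 2a<p with a ∈? λs | p ∸ a ∈? λs
... | yes a∈ | _      = inj₁ a∈
... | no _   | yes b∈ = inj₂ b∈
... | no a∉  | no b∉  = ⊥-elim (unrefinable
  (a , p ∸ a , a≢b , (1≤a , a≤p≤largest , a∉) , (1≤b , b≤p≤largest , b∉) , a+b∈))
  where
    a<p = <-trans (m<m+n a 1≤a) 2a<p
    a+b≡p = m+[n∸m]≡n (<⇒≤ a<p)
    a≢b : a ≢ p ∸ a
    a≢b a≡b = <⇒≢ 2a<p (trans (cong (a +_) a≡b) a+b≡p)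
    a≤p≤largest = ≤-trans (<⇒≤ a<p) (≤-largest p∈)
    b≤p≤largest = ≤-trans (m∸n≤m p a) (≤-largest p∈)
    1≤b = m<n⇒0<n∸m a<p
    a+b∈ = subst (_∈ λs) (sym a+b≡p) p∈

record PairCover (μ : List ℕ) (L : ℕ) : Set where
  field
    increasing : AllPairs _<_ μ
    positive   : ∀ {x} → x ∈ μ → 1 ≤ x
    top        : L ∈ μ
    bounded    : ∀ {x} → x ∈ μ → x ≤ L
    split      : ∀ {a} → 1 ≤ a → a + a < L → a ∈ μ ⊎ L ∸ a ∈ μ

pairCover : ∀ {N μ} → InU N μ → PairCover μ (largest μ)
pairCover {μ = []} (partition , _) with DistinctPartition.atLeastTwo partition
... | ()
pairCover {μ = x ∷ xs} (partition , unrefinable) = record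
  { increasing = Linked⇒AllPairs <-trans (DistinctPartition.increasing partition)
  ; positive   = All.lookup (DistinctPartition.positive partition)
  ; top        = largest-∈ x xs
  ; bounded    = ≤-largest
  ; split      = split-part unrefinable (largest-∈ x xs)
  }

module _ {μ L} (cover : PairCover μ L) where
  open PairCover cover

  sum≡rangeSum : sum μ ≡ rangeSum (weight μ) 1 L
  sum≡rangeSum = sum≡rangeSum-weight 1 L increasing (λ x∈ → positive x∈ , s≤s (bounded x∈))

  ≤-pairSum : ∀ {a} → 1 ≤ a → a + a < L → a ≤ pairSum (weight μ) L a
  ≤-pairSum {a} 1≤a 2a<L with split 1≤a 2a<L
  ... | inj₁ a∈ = ≤-trans (≤-reflexive (sym (weight-∈ μ a∈))) (m≤m+n _ _)
  ... | inj₂ b∈ = ≤-trans (m+n≤o⇒m≤o∸n a (<⇒≤ 2a<L))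
                          (≤-trans (≤-reflexive (sym (weight-∈ μ b∈))) (m≤n+m _ _))

  triangle+top≤sum : ∀ {m} → m + m < L → triangle m + L ≤ sum μ
  triangle+top≤sum {m} 2m<L with m≤n⇒∃[o]m+o≡n 2m<L
  ... | d , 2m+d≡L = begin
    triangle m + L
      ≤⟨ +-monoˡ-≤ L pairs≥ ⟩
    rangeSum (pairSum (weight μ) L) 1 m + L
      ≤⟨ +-monoˡ-≤ L (m≤m+n _ _) ⟩
    rangeSum (pairSum (weight μ) L) 1 m + rangeSum (weight μ) (suc m) d + L
      ≡⟨ cong (rangeSum (pairSum (weight μ) L) 1 m + rangeSum (weight μ) (suc m) d +_)
              (sym (weight-∈ μ top)) ⟩
    rangeSum (pairSum (weight μ) L) 1 m + rangeSum (weight μ) (suc m) d + weight μ L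
      ≡⟨ sym (rangeSum-fold (weight μ) m d (trans (cong suc (shape m d)) 2m+d≡L)) ⟩
    rangeSum (weight μ) 1 L
      ≡⟨ sym sum≡rangeSum ⟩
    sum μ ∎
    where
      open ≤-Reasoning
      shape : ∀ m d → m + d + m ≡ m + m + d
      shape = solve-∀
      pairs≥ : triangle m ≤ rangeSum (pairSum (weight μ) L) 1 m
      pairs≥ = subst (_≤ rangeSum (pairSum (weight μ) L) 1 m) (rangeSum-id m)
        (rangeSum-mono {λ a → a} {pairSum (weight μ) L} 1 m λ (1≤a , a<1+m) →
        ≤-pairSum 1≤a (≤-<-trans (+-mono-≤ (s≤s⁻¹ a<1+m) (s≤s⁻¹ a<1+m)) 2m<L))

-- For n = j + 5, total j is T_{n,n-3} and 6 + (j + j) is 2n - 4.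

total : ℕ → ℕ
total j = triangle j + (13 + 4 * j)

total≡T : ∀ j → T (5 + j) (2 + j) ≡ total j
total≡T j = begin
  (n * suc n) / 2 ∸ (2 + j)    ≡⟨ cong (λ x → x / 2 ∸ (2 + j)) (sym (triangle-*2 n)) ⟩
  triangle n * 2 / 2 ∸ (2 + j) ≡⟨ cong (_∸ (2 + j)) (m*n/n≡m (triangle n) 2) ⟩
  triangle n ∸ (2 + j)         ≡⟨ cong (_∸ (2 + j)) (expand (triangle j) j) ⟩
  total j + (2 + j) ∸ (2 + j)  ≡⟨ m+n∸n≡m (total j) (2 + j) ⟩
  total j                      ∎
  where
    open ≡-Reasoning
    n = 5 + j
    expand : ∀ t j → t + suc j + suc (suc j) + (3 + j) + (4 + j) + (5 + j) ≡ t + (13 + 4 * j) + (2 + j)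
    expand = solve-∀

top-≤-2j+6 : ∀ {j μ L} → 1 ≤ j → PairCover μ L → sum μ ≡ total j → L ≤ 6 + (j + j)
top-≤-2j+6 {j} {μ} {L} 1≤j cover sum≡ with L ≤? 6 + (j + j)
... | yes L≤ = L≤
... | no  L≰ = ⊥-elim (<⇒≱ too-big (subst (triangle (3 + j) + L ≤_) sum≡ (triangle+top≤sum cover 2m<L)))
  where
    open ≤-Reasoning
    7+2j≤L : 7 + (j + j) ≤ L
    7+2j≤L = ≰⇒> L≰
    2m<L : (3 + j) + (3 + j) < L
    2m<L = subst (_≤ L) (double j) 7+2j≤L
      where double : ∀ j → 7 + (j + j) ≡ suc ((3 + j) + (3 + j))
            double = solve-∀
    too-big : total j < triangle (3 + j) + L
    too-big = begin-strict
      total j                          <⟨ m<m+n (total j) 1≤j ⟩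
      total j + j                      ≡⟨ expand (triangle j) j ⟩
      triangle (3 + j) + (7 + (j + j)) ≤⟨ +-monoʳ-≤ (triangle (3 + j)) 7+2j≤L ⟩
      triangle (3 + j) + L             ∎
      where expand : ∀ t j → t + (13 + 4 * j) + j ≡
                             t + suc j + suc (suc j) + suc (suc (suc j)) + (7 + (j + j))
            expand = solve-∀

-- The extremal partition

extremal : ℕ → List ℕ
extremal j = applyUpTo suc j ++ 2 + j ∷ 5 + j ∷ 6 + (j + j) ∷ []

data ExtremalPart (j : ℕ) : ℕ → Set where
  at-≤j    : ∀ {a} → 1 ≤ a → a ≤ j → ExtremalPart j a
  at-j+2   : ExtremalPart j (2 + j)
  at-j+5   : ExtremalPart j (5 + j)
  at-2j+6  : ExtremalPart j (6 + (j + j))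

∈-extremal⁻ : ∀ {j z} → z ∈ extremal j → ExtremalPart j z
∈-extremal⁻ {j} z∈ with ∈-++⁻ (applyUpTo suc j) z∈
... | inj₁ z∈₁ with (i , i<j , refl) ← ∈-applyUpTo⁻ suc z∈₁ = at-≤j (s≤s z≤n) i<j
... | inj₂ (here refl)                 = at-j+2
... | inj₂ (there (here refl))         = at-j+5
... | inj₂ (there (there (here refl))) = at-2j+6

∈-extremal⁺ : ∀ {j z} → ExtremalPart j z → z ∈ extremal j
∈-extremal⁺ {j} (at-≤j {suc i} _ i<j) = ∈-++⁺ˡ (∈-applyUpTo⁺ suc i<j)
∈-extremal⁺ {j} at-j+2  = ∈-++⁺ʳ (applyUpTo suc j) (here refl)
∈-extremal⁺ {j} at-j+5  = ∈-++⁺ʳ (applyUpTo suc j) (there (here refl))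
∈-extremal⁺ {j} at-2j+6 = ∈-++⁺ʳ (applyUpTo suc j) (there (there (here refl)))

extremalPart-≤ : ∀ {j z} → ExtremalPart j z → z ≤ 6 + (j + j)
extremalPart-≤ {j} (at-≤j _ z≤j) = ≤-trans z≤j (≤-trans (m≤m+n j j) (m≤n+m (j + j) 6))
extremalPart-≤ {j} at-j+2  = +-mono-≤ {2} {6} (s≤s (s≤s z≤n)) (m≤m+n j j)
extremalPart-≤ {j} at-j+5  = +-mono-≤ {5} {6} (s≤s (s≤s (s≤s (s≤s (s≤s z≤n))))) (m≤m+n j j)
extremalPart-≤ {j} at-2j+6 = ≤-refl

extremalPart-pos : ∀ {j z} → ExtremalPart j z → 1 ≤ z
extremalPart-pos (at-≤j 1≤z _) = 1≤z
extremalPart-pos at-j+2  = s≤s z≤n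
extremalPart-pos at-j+5  = s≤s z≤n
extremalPart-pos at-2j+6 = s≤s z≤n

extremal-increasing : ∀ j → AllPairs _<_ (extremal j)
extremal-increasing j =
  AllPairs.++⁺ (AllPairs.applyUpTo⁺₁ suc j (λ i<k _ → s≤s i<k))
               ((j+2<j+5 ∷ j+2<2j+6 ∷ []) ∷ (j+5<2j+6 ∷ []) ∷ [] ∷ [])
               (All.applyUpTo⁺₁ suc j λ i<j →
                  let i+1<j+2 = s≤s (≤-trans i<j (n≤1+n j))
                  in  i+1<j+2 ∷ <-trans i+1<j+2 j+2<j+5 ∷ <-trans i+1<j+2 j+2<2j+6 ∷ [])
  where
    j+2<j+5 : 2 + j < 5 + j
    j+2<j+5 = +-monoˡ-< j (s<s (s<s z<s))
    j+5<2j+6 : 5 + j < 6 + (j + j)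
    j+5<2j+6 = +-mono-<-≤ {5} {6} (s<s (s<s (s<s (s<s (s<s z<s))))) (m≤m+n j j)
    j+2<2j+6 : 2 + j < 6 + (j + j)
    j+2<2j+6 = <-trans j+2<j+5 j+5<2j+6

largest-extremal : ∀ j → largest (extremal j) ≡ 6 + (j + j)
largest-extremal j = ≤-antisym (largest-≤ (extremal j) (λ z∈ → extremalPart-≤ (∈-extremal⁻ {j} z∈)))
                               (≤-largest (∈-extremal⁺ {j} at-2j+6))

sum-extremal : ∀ j → sum (extremal j) ≡ total j
sum-extremal j = begin
  sum (applyUpTo suc j ++ rest)         ≡⟨ sum-++ (applyUpTo suc j) rest ⟩
  sum (applyUpTo suc j) + sum rest      ≡⟨ cong (_+ sum rest) first-j ⟩
  triangle j + sum rest                 ≡⟨ add (triangle j) j ⟩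
  total j                               ∎
  where
    open ≡-Reasoning
    rest = 2 + j ∷ 5 + j ∷ 6 + (j + j) ∷ []
    first-j : sum (applyUpTo suc j) ≡ triangle j
    first-j = trans (sum-applyUpTo suc j) (trans (rangeSum-shift (λ a → a) 0 j) (rangeSum-id j))
    add : ∀ t j → t + (2 + j + (5 + j + (6 + (j + j) + 0))) ≡ t + (13 + 4 * j)
    add = solve-∀

extremal-partition : ∀ j → DistinctPartition (total j) (extremal j)
extremal-partition j = record
  { increasing = AllPairs⇒Linked (extremal-increasing j)
  ; positive   = All.tabulate (λ z∈ → extremalPart-pos (∈-extremal⁻ {j} z∈))
  ; atLeastTwo = subst (2 ≤_) (sym (length-++ (applyUpTo suc j))) (≤-trans (n≤1+n 2) (m≤n+m 3 (length (applyUpTo suc j))))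
  ; sumIsN     = sum-extremal j
  }

∉-extremal⇒j< : ∀ {j a} → 1 ≤ a → a ∉ extremal j → j < a
∉-extremal⇒j< {j} {a} 1≤a a∉ with a ≤? j
... | yes a≤j = ⊥-elim (a∉ (∈-extremal⁺ (at-≤j 1≤a a≤j)))
... | no  a≰j = ≰⇒> a≰j

suc-+-comm : ∀ j k → suc j + k ≡ suc k + j
suc-+-comm j k = cong suc (+-comm j k)

-- Missing parts exceed j, so two of them, j + 1 + s and j + 1 + t, can only sum to
-- the part 2j + 6, with s + t = 4; but then one of them is j + 2 or j + 5.
extremal-unrefinable : ∀ {j} → 6 ≤ j → Unrefinable (extremal j)
extremal-unrefinable {j} 6≤j (a , b , a≢b , (1≤a , _ , a∉) , (1≤b , _ , b∉) , a+b∈)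
  with m≤n⇒∃[o]m+o≡n (∉-extremal⇒j< 1≤a a∉) | m≤n⇒∃[o]m+o≡n (∉-extremal⇒j< 1≤b b∉)
... | s , refl | t , refl = excluded (∈-extremal⁻ a+b∈) refl
  where
    a+b≡ : ∀ j s t → (suc j + s) + (suc j + t) ≡ 2 + (j + j) + (s + t)
    a+b≡ = solve-∀

    j+5<a+b : 5 + j < (suc j + s) + (suc j + t)
    j+5<a+b = begin-strict
      5 + j                  <⟨ n<1+n _ ⟩
      6 + j                  ≤⟨ +-monoˡ-≤ j 6≤j ⟩
      j + j                  ≤⟨ m≤n+m _ 2 ⟩
      2 + (j + j)            ≤⟨ m≤m+n _ (s + t) ⟩
      2 + (j + j) + (s + t)  ≡⟨ sym (a+b≡ j s t) ⟩
      (suc j + s) + (suc j + t) ∎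
      where open ≤-Reasoning

    hit : ∀ {s t} → s + t ≡ 4 → s ≢ t → suc j + s ∈ extremal j ⊎ suc j + t ∈ extremal j
    hit {0} refl _ = inj₂ (subst (_∈ extremal j) (sym (suc-+-comm j 4)) (∈-extremal⁺ at-j+5))
    hit {1} refl _ = inj₁ (subst (_∈ extremal j) (sym (suc-+-comm j 1)) (∈-extremal⁺ at-j+2))
    hit {2} refl s≢t = ⊥-elim (s≢t refl)
    hit {3} refl _ = inj₂ (subst (_∈ extremal j) (sym (suc-+-comm j 1)) (∈-extremal⁺ at-j+2))
    hit {4} refl _ = inj₁ (subst (_∈ extremal j) (sym (suc-+-comm j 4)) (∈-extremal⁺ at-j+5))

    excluded : ∀ {z} → ExtremalPart j z → z ≡ (suc j + s) + (suc j + t) → ⊥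
    excluded (at-≤j _ z≤j) refl = n≮n j (≤-trans (m≤m+n (suc j) s) (≤-trans (m≤m+n _ _) z≤j))
    excluded at-j+2  z≡ = <⇒≢ (<-trans (+-monoˡ-< j (s<s (s<s z<s))) j+5<a+b) z≡
    excluded at-j+5  z≡ = <⇒≢ j+5<a+b z≡
    excluded at-2j+6 z≡ with hit s+t≡4 (λ s≡t → a≢b (cong (suc j +_) s≡t))
      where
        s+t≡4 : s + t ≡ 4
        s+t≡4 = +-cancelˡ-≡ (2 + (j + j)) (s + t) 4
                  (trans (sym (a+b≡ j s t)) (trans (sym z≡) (sym (+-comm (2 + (j + j)) 4))))
    ... | inj₁ a∈ = a∉ a∈
    ... | inj₂ b∈ = b∉ b∈

data PairShape (μ : List ℕ) (a s : ℕ) : ℕ → Set where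
  lower : a ∈ μ → a + s ∉ μ → PairShape μ a s 0
  upper : a ∉ μ → a + s ∈ μ → PairShape μ a s s
  both  : a ∈ μ → a + s ∈ μ → PairShape μ a s (a + s)

pairShape : ∀ {μ L a s} → L ∸ a ≡ a + s → a ∈ μ ⊎ L ∸ a ∈ μ →
            ∃ λ e → pairSum (weight μ) L a ≡ a + e × PairShape μ a s e
pairShape {μ} {L} {a} {s} L∸a≡ covered = by-cases (a ∈? μ) (a + s ∈? μ)
  where
    w≡ : weight μ (L ∸ a) ≡ weight μ (a + s)
    w≡ = cong (weight μ) L∸a≡
    by-cases : Dec (a ∈ μ) → Dec (a + s ∈ μ) →
               ∃ λ e → pairSum (weight μ) L a ≡ a + e × PairShape μ a s e
    by-cases (yes a∈) (no b∉)  = 0 , cong₂ _+_ (weight-∈ μ a∈) (trans w≡ (weight-∉ μ b∉)) , lower a∈ b∉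
    by-cases (no a∉)  (yes b∈) = s , cong₂ _+_ (weight-∉ μ a∉) (trans w≡ (weight-∈ μ b∈)) , upper a∉ b∈
    by-cases (yes a∈) (yes b∈) = a + s , cong₂ _+_ (weight-∈ μ a∈) (trans w≡ (weight-∈ μ b∈)) , both a∈ b∈
    by-cases (no a∉)  (no b∉)  = ⊥-elim ([ a∉ , (λ b∈ → b∉ (subst (_∈ μ) L∸a≡ b∈)) ]′ covered)

pairShape-excess : ∀ {μ a s e} → PairShape μ a s e → e ≡ 0 ⊎ s ≤ e
pairShape-excess (lower _ _) = inj₁ refl
pairShape-excess (upper _ _) = inj₂ ≤-refl
pairShape-excess {a = a} {s} (both _ _) = inj₂ (m≤n+m s a)

pairShape-lower : ∀ {μ a s e} → 1 ≤ s → PairShape μ a s e → e ≡ 0 → a ∈ μ × a + s ∉ μ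
pairShape-lower _   (lower a∈ b∉) _ = a∈ , b∉
pairShape-lower 1≤s (upper _ _)   s≡0 = ⊥-elim (<⇒≢ 1≤s (sym s≡0))
pairShape-lower {a = a} {s} 1≤s (both _ _) a+s≡0 = ⊥-elim (<⇒≢ (≤-trans 1≤s (m≤n+m s a)) (sym a+s≡0))

record MiddleParts (μ : List ℕ) (j : ℕ) : Set where
  field
    j+1∉ : 1 + j ∉ μ
    j+2∈ : 2 + j ∈ μ
    j+3∉ : 3 + j ∉ μ
    j+4∉ : 4 + j ∉ μ
    j+5∈ : 5 + j ∈ μ

-- With L = 2j + 6 the middle pairs are {j + 1, j + 5}, {j + 2, j + 4} and the single j + 3.
middle-forced : ∀ {μ j e₁ e₂} → 2 ≤ j → PairShape μ (1 + j) 4 e₁ → PairShape μ (2 + j) 2 e₂ →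
                e₁ + (e₂ + weight μ (3 + j)) ≡ 4 → MiddleParts μ j
middle-forced {μ} {j} {e₁} {e₂} 2≤j shape₁ shape₂ total≡4 = by-cases (3 + j ∈? μ)
  where
    over4 : ∀ {x n} → 5 ≤ x → x ≤ n → n ≢ 4
    over4 5≤x x≤n n≡4 = <⇒≢ (≤-trans 5≤x x≤n) (sym n≡4)

    j+2+2≥5 : 5 ≤ (2 + j) + 2
    j+2+2≥5 = +-monoˡ-≤ 2 (s≤s (s≤s (≤-trans (s≤s z≤n) 2≤j)))

    forced : ∀ {e₁ e₂} → 3 + j ∉ μ → PairShape μ (1 + j) 4 e₁ → PairShape μ (2 + j) 2 e₂ →
             e₁ + (e₂ + 0) ≡ 4 → MiddleParts μ j
    forced j+3∉ (upper j+1∉ j+5∈) (lower j+2∈ j+4∉) _ = record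
      { j+1∉ = j+1∉
      ; j+2∈ = j+2∈
      ; j+3∉ = j+3∉
      ; j+4∉ = j+4∉ ∘ subst (_∈ μ) (sym (suc-+-comm (suc j) 2))
      ; j+5∈ = subst (_∈ μ) (suc-+-comm j 4) j+5∈
      }
    forced _ (lower _ _) (lower _ _) ()
    forced _ (lower _ _) (upper _ _) ()
    forced _ (upper _ _) (upper _ _) ()
    forced {e₂ = e₂} _ (both _ _) _ e≡4 =
      ⊥-elim (over4 (+-monoˡ-≤ 4 (s≤s z≤n)) (m≤m+n ((1 + j) + 4) (e₂ + 0)) e≡4)
    forced {e₁} _ (lower _ _) (both _ _) e≡4 = ⊥-elim (over4 j+2+2≥5 (≤-trans (m≤m+n _ 0) (m≤n+m _ e₁)) e≡4)
    forced {e₁} _ (upper _ _) (both _ _) e≡4 = ⊥-elim (over4 j+2+2≥5 (≤-trans (m≤m+n _ 0) (m≤n+m _ e₁)) e≡4)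

    by-cases : Dec (3 + j ∈ μ) → MiddleParts μ j
    by-cases (yes j+3∈) = ⊥-elim (over4 (+-monoʳ-≤ 3 2≤j) j+3≤total total≡4)
      where j+3≤total = ≤-trans (≤-reflexive (sym (weight-∈ μ j+3∈)))
                                (≤-trans (m≤n+m _ e₂) (m≤n+m _ e₁))
    by-cases (no j+3∉)  =
      forced j+3∉ shape₁ shape₂ (trans (cong (λ d → e₁ + (e₂ + d)) (sym (weight-∉ μ j+3∉))) total≡4)

module Uniqueness {j μ} (6≤j : 6 ≤ j) (cover : PairCover μ (6 + (j + j))) (sum≡ : sum μ ≡ total j) where
  open PairCover cover

  private
    L : ℕ
    L = 6 + (j + j)

    c : ℕ → ℕ
    c = weight μ

    L∸-≡ : ∀ a {b} → L ≡ a + b → L ∸ a ≡ b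
    L∸-≡ a {b} L≡ = trans (cong (_∸ a) L≡) (m+n∸m≡n a b)

  low-shape : ∀ {a} → 1 ≤ a → a ≤ j →
              ∃₂ λ s e → 6 ≤ s × L ∸ a ≡ a + s × pairSum c L a ≡ a + e × PairShape μ a s e
  low-shape {a} 1≤a a≤j =
    s , proj₁ shape , 6≤s , L∸a≡ , proj₁ (proj₂ shape) , proj₂ (proj₂ shape)
    where
      2a≤2j = +-mono-≤ a≤j a≤j
      s = L ∸ (a + a)
      6≤s : 6 ≤ s
      6≤s = subst (_≤ s) (m+n∸n≡m 6 (j + j)) (∸-monoʳ-≤ L 2a≤2j)
      L∸a≡ : L ∸ a ≡ a + s
      L∸a≡ = L∸-≡ a (trans (sym (m+[n∸m]≡n (≤-trans 2a≤2j (m≤n+m _ 6)))) (+-assoc a a s))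
      shape = pairShape {μ} L∸a≡ (split 1≤a (s≤s (≤-trans 2a≤2j (m≤n+m _ 5))))

  low-pairs : OnRange (λ a → pairSum c L a ≡ a ⊎ a + 6 ≤ pairSum c L a) 1 j
  low-pairs {a} (1≤a , a<1+j) with low-shape 1≤a (s≤s⁻¹ a<1+j)
  ... | s , e , 6≤s , _ , P≡ , shape with pairShape-excess shape
  ...   | inj₁ refl = inj₁ (trans P≡ (+-identityʳ a))
  ...   | inj₂ s≤e  = inj₂ (subst (a + 6 ≤_) (sym P≡) (+-monoʳ-≤ a (≤-trans 6≤s s≤e)))

  private
    <-by : ∀ {x y} k → suc x + k ≡ y → x < y
    <-by {x} k refl = m≤m+n (suc x) k

    shape₁ = pairShape {μ} {L} {1 + j} {4} (L∸-≡ (1 + j) (split₁ j)) (split (s≤s z≤n) (<-by 3 (gap₁ j)))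
      where split₁ : ∀ j → 6 + (j + j) ≡ (1 + j) + ((1 + j) + 4)
            split₁ = solve-∀
            gap₁ : ∀ j → suc ((1 + j) + (1 + j)) + 3 ≡ 6 + (j + j)
            gap₁ = solve-∀
    shape₂ = pairShape {μ} {L} {2 + j} {2} (L∸-≡ (2 + j) (split₂ j)) (split (s≤s z≤n) (<-by 1 (gap₂ j)))
      where split₂ : ∀ j → 6 + (j + j) ≡ (2 + j) + ((2 + j) + 2)
            split₂ = solve-∀
            gap₂ : ∀ j → suc ((2 + j) + (2 + j)) + 1 ≡ 6 + (j + j)
            gap₂ = solve-∀
    e₁ = proj₁ shape₁
    e₂ = proj₁ shape₂
    X  = rangeSum (pairSum c L) 1 j

  decomposition : sum μ ≡ X + pairSum c L (1 + j) + pairSum c L (2 + j) + (c (3 + j) + 0) + c L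
  decomposition = begin
    sum μ
      ≡⟨ sum≡rangeSum cover ⟩
    rangeSum c 1 L
      ≡⟨ rangeSum-fold c (2 + j) 1 (around j) ⟩
    rangeSum (pairSum c L) 1 (2 + j) + rangeSum c (3 + j) 1 + c L
      ≡⟨ cong (λ p → p + (c (3 + j) + 0) + c L) two-more ⟩
    X + pairSum c L (1 + j) + pairSum c L (2 + j) + (c (3 + j) + 0) + c L ∎
    where
      open ≡-Reasoning
      around : ∀ j → suc ((2 + j) + 1 + (2 + j)) ≡ 6 + (j + j)
      around = solve-∀
      two-more : rangeSum (pairSum c L) 1 (2 + j) ≡ X + pairSum c L (1 + j) + pairSum c L (2 + j)
      two-more = trans (rangeSum-snoc (pairSum c L) 1 (1 + j))
                       (cong (_+ pairSum c L (2 + j)) (rangeSum-snoc (pairSum c L) 1 j))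

  excess : X + (e₁ + (e₂ + c (3 + j))) ≡ triangle j + 4
  excess = +-cancelʳ-≡ (9 + 4 * j) _ _ (begin
    X + (e₁ + (e₂ + D)) + (9 + 4 * j)
      ≡⟨ spread X e₁ e₂ D j ⟩
    X + ((1 + j) + e₁) + ((2 + j) + e₂) + (D + 0) + L
      ≡⟨ cong₂ (λ p₁ p₂ → X + p₁ + p₂ + (D + 0) + L) (sym (proj₁ (proj₂ shape₁))) (sym (proj₁ (proj₂ shape₂))) ⟩
    X + pairSum c L (1 + j) + pairSum c L (2 + j) + (D + 0) + L
      ≡⟨ cong (X + pairSum c L (1 + j) + pairSum c L (2 + j) + (D + 0) +_) (sym (weight-∈ μ top)) ⟩
    X + pairSum c L (1 + j) + pairSum c L (2 + j) + (D + 0) + c L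
      ≡⟨ sym decomposition ⟩
    sum μ
      ≡⟨ sum≡ ⟩
    total j
      ≡⟨ budget (triangle j) j ⟩
    triangle j + 4 + (9 + 4 * j) ∎)
    where
      open ≡-Reasoning
      D = c (3 + j)
      spread : ∀ X e₁ e₂ D j → X + (e₁ + (e₂ + D)) + (9 + 4 * j) ≡
                               X + ((1 + j) + e₁) + ((2 + j) + e₂) + (D + 0) + (6 + (j + j))
      spread = solve-∀
      budget : ∀ t j → t + (13 + 4 * j) ≡ t + 4 + (9 + 4 * j)
      budget = solve-∀

  pairs-exact : OnRange (λ a → pairSum c L a ≡ a) 1 j
  pairs-exact = rangeSum-rigid 5 1 j low-pairs (begin
    X                                  ≤⟨ m≤m+n X _ ⟩
    X + (e₁ + (e₂ + c (3 + j)))        ≡⟨ excess ⟩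
    triangle j + 4                     ≤⟨ +-monoʳ-≤ (triangle j) (n≤1+n 4) ⟩
    triangle j + 5                     ≡⟨ cong (_+ 5) (sym (rangeSum-id j)) ⟩
    rangeSum (λ a → a) 1 j + 5         ∎)
    where open ≤-Reasoning

  middle : MiddleParts μ j
  middle = middle-forced (≤-trans (s≤s (s≤s z≤n)) 6≤j) (proj₂ (proj₂ shape₁)) (proj₂ (proj₂ shape₂))
    (+-cancelˡ-≡ (triangle j) _ _ (trans (cong (_+ (e₁ + (e₂ + c (3 + j)))) (sym X≡triangle)) excess))
    where X≡triangle = trans (rangeSum-cong 1 j pairs-exact) (rangeSum-id j)

  low-parts : ∀ {a} → 1 ≤ a → a ≤ j → a ∈ μ × L ∸ a ∉ μ
  low-parts {a} 1≤a a≤j = from-shape (low-shape 1≤a a≤j)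
    where
      exact : pairSum c L a ≡ a
      exact = pairs-exact (1≤a , s≤s a≤j)
      from-shape : (∃₂ λ s e → 6 ≤ s × L ∸ a ≡ a + s × pairSum c L a ≡ a + e × PairShape μ a s e) →
                   a ∈ μ × L ∸ a ∉ μ
      from-shape (s , e , 6≤s , L∸a≡ , P≡ , shape) =
        let a∈ , a+s∉ = pairShape-lower (≤-trans (s≤s z≤n) 6≤s) shape e≡0
        in  a∈ , a+s∉ ∘ subst (_∈ μ) L∸a≡
        where e≡0 = +-cancelˡ-≡ a e 0 (trans (sym P≡) (trans exact (sym (+-identityʳ a))))

  beyond-middle : ∀ {z} → 6 + j ≤ z → z ∈ μ → z ≡ L
  beyond-middle {z} 6+j≤z z∈ with z ≟ L
  ... | yes z≡L = z≡L
  ... | no  z≢L = ⊥-elim (proj₂ (low-parts 1≤L∸z L∸z≤j) (subst (_∈ μ) (sym (m∸[m∸n]≡n (bounded z∈))) z∈))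
    where
      1≤L∸z = m<n⇒0<n∸m (≤∧≢⇒< (bounded z∈) z≢L)
      L∸z≤j = ≤-trans (∸-monoʳ-≤ L 6+j≤z) (≤-reflexive (L∸-≡ (6 + j) (sym (+-assoc 6 j j))))

  classify : ∀ {z} → z ∈ μ → ExtremalPart j z
  classify {z} z∈ with z ≤? j
  ... | yes z≤j = at-≤j (positive z∈) z≤j
  ... | no  z≰j with m≤n⇒∃[o]m+o≡n (≰⇒> z≰j)
  ...   | t , refl = above t z∈
    where
      open MiddleParts middle
      above : ∀ t → suc j + t ∈ μ → ExtremalPart j (suc j + t)
      above 0 j+1∈ = ⊥-elim (j+1∉ (subst (_∈ μ) (+-identityʳ (suc j)) j+1∈))
      above 1 _    = subst (ExtremalPart j) (sym (suc-+-comm j 1)) at-j+2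
      above 2 j+3∈ = ⊥-elim (j+3∉ (subst (_∈ μ) (suc-+-comm j 2) j+3∈))
      above 3 j+4∈ = ⊥-elim (j+4∉ (subst (_∈ μ) (suc-+-comm j 3) j+4∈))
      above 4 _    = subst (ExtremalPart j) (sym (suc-+-comm j 4)) at-j+5
      above (suc (suc (suc (suc (suc u))))) z∈ =
        subst (ExtremalPart j) (sym (beyond-middle 6+j≤z z∈)) at-2j+6
        where 6+j≤z = subst (_≤ suc j + (5 + u)) (suc-+-comm j 5) (+-monoʳ-≤ (suc j) (m≤m+n 5 u))

  extremal⊆μ : ∀ {z} → ExtremalPart j z → z ∈ μ
  extremal⊆μ (at-≤j 1≤z z≤j) = proj₁ (low-parts 1≤z z≤j)
  extremal⊆μ at-j+2  = MiddleParts.j+2∈ middle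
  extremal⊆μ at-j+5  = MiddleParts.j+5∈ middle
  extremal⊆μ at-2j+6 = top

  μ≡extremal : μ ≡ extremal j
  μ≡extremal = strictlyIncreasing-≡ increasing (extremal-increasing j)
                 (λ z∈ → ∈-extremal⁺ (classify z∈)) (λ z∈ → extremal⊆μ (∈-extremal⁻ z∈))

extremal-∈U : ∀ {j} → 6 ≤ j → InU (total j) (extremal j)
extremal-∈U {j} 6≤j = extremal-partition j , extremal-unrefinable 6≤j

largest-≤-2j+6 : ∀ {j μ} → 1 ≤ j → InU (total j) μ → largest μ ≤ 6 + (j + j)
largest-≤-2j+6 1≤j μ∈U@(partition , _) =
  top-≤-2j+6 1≤j (pairCover μ∈U) (DistinctPartition.sumIsN partition)

extremal-∈U* : ∀ {j} → 6 ≤ j → InUStar (total j) (extremal j)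
extremal-∈U* {j} 6≤j = extremal-∈U 6≤j , λ μ μ∈U →
  subst (largest μ ≤_) (sym (largest-extremal j)) (largest-≤-2j+6 (≤-trans (s≤s z≤n) 6≤j) μ∈U)

∈U*-unique : ∀ {j μ} → 6 ≤ j → InUStar (total j) μ → μ ≡ extremal j
∈U*-unique {j} {μ} 6≤j (μ∈U@(partition , _) , maximal) =
  Uniqueness.μ≡extremal 6≤j (subst (PairCover μ) largest≡ (pairCover μ∈U)) (DistinctPartition.sumIsN partition)
  where
    largest≡ : largest μ ≡ 6 + (j + j)
    largest≡ = ≤-antisym (largest-≤-2j+6 (≤-trans (s≤s z≤n) 6≤j) μ∈U)
                         (subst (_≤ largest μ) (largest-extremal j) (maximal (extremal j) (extremal-∈U 6≤j)))

corollary3p2 : (n : ℕ) → 11 ≤ n →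
    Σ (List ℕ) λ λs → InUStar (T n (n ∸ 3)) λs ×
      (∀ μ → InUStar (T n (n ∸ 3)) μ → μ ≡ λs)
corollary3p2 (suc (suc (suc (suc (suc j))))) (s≤s (s≤s (s≤s (s≤s (s≤s 6≤j))))) =
  subst (λ N → Σ (List ℕ) λ λs → InUStar N λs × (∀ μ → InUStar N μ → μ ≡ λs))
        (sym (total≡T j))
        (extremal j , extremal-∈U* 6≤j , λ μ → ∈U*-unique 6≤j)
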